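{- Let $n\ge1$, $(m_1,\dots,m_n)$ a sequence of positive integers and $(j_2,\dots,j_n)\in\{0,1\}^{n-1}$. The number of rps tableaux over $\mathcal{A}_n$ with evaluation $(m_1,\dots,m_n)$ whose bottom row has evaluation $(1,j_2,\dots,j_n)$ equals $$\prod_{a=2}^{n}\binom{m_a+j_2+\cdots+j_{a-1}}{m_a-j_a}.$$
   Context: $\mathcal{A}_n=\{1<\cdots<n\}$. A composition diagram is a finite left-to-right sequence of nonempty bottom-justified columns of boxes; the bottom row consists of the lowest box of each column. An rps tableau over $\mathcal{A}_n$ is a filling of a composition diagram by elements of $\mathcal{A}_n$ such that each column is weakly increasing from bottom to top and the bottom row is strictly increasing from left to right. It has evaluation $(m_1,\dots,m_n)$ if each symbol $a$ occurs exactly $m_a$ times; the bottom row has evaluation $(e_1,\dots,e_n)$ if symbol $a$ occurs $e_a$ times in the bottom row. Convention: $\binom{m}{k}=0$ for $k>m$; empty products equal $1$. -}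

module Defs where

open import Data.Nat using (ℕ; zero; suc; _+_; _∸_)
open import Data.Nat.Combinatorics using (_C_)
open import Data.Bool using (Bool; true; false; if_then_else_)
open import Data.Fin using (Fin; zero; suc; toℕ; _≟_; _≤_; _<_)
open import Data.Fin.Properties using (_<?_)
open import Data.List using (List; map; concatMap; filter; length; allFin)
open import Data.Nat.ListAction using (sum; product)
open import Data.List.NonEmpty using (List⁺; head; toList)
open import Data.List.Relation.Unary.Linked using (Linked)
open import Data.Product using (Σ; _×_)
open import Data.List.Relation.Unary.All using (All)
open import Data.Vec using (Vec; _∷_; tabulate; lookup)
import Data.Vec as Vec
open import Relation.Nullary.Decidable using (⌊_⌋)
open import Relation.Binary.PropositionalEquality using (_≡_)

-- Symbols of A_n = {1 < ... < n} are represented by Fin n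
-- (the symbol a corresponds to the element of Fin n with toℕ = a - 1).

-- A column, listed from bottom to top; nonempty by construction.
Column : ℕ → Set
Column n = List⁺ (Fin n)

-- A filling of a composition diagram: the list of its columns, left to right.
Filling : ℕ → Set
Filling n = List (Column n)

bottomRow : ∀ {n} → Filling n → List (Fin n)
bottomRow = map head

entries : ∀ {n} → Filling n → List (Fin n)
entries = concatMap toList

occ : ∀ {n} → Fin n → List (Fin n) → ℕ
occ a xs = length (filter (_≟ a) xs)

IsRPS : ∀ {n} → Filling n → Set
IsRPS T = All (λ c → Linked _≤_ (toList c)) T × Linked _<_ (bottomRow T)

evalOf : ∀ {n} → List (Fin n) → Vec ℕ n
evalOf xs = tabulate (λ a → occ a xs)

RPSTableau : (n : ℕ) → Vec ℕ n → Vec ℕ n → Set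
RPSTableau n m e = Σ (Filling n) λ T → IsRPS T × (evalOf (entries T) ≡ m) × (evalOf (bottomRow T) ≡ e)

bit : Bool → ℕ
bit b = if b then 1 else 0

-- bottom-row evaluation (1, j_2, ..., j_n); j is indexed so that lookup j i = j_{i+2}.
bottomEval : ∀ {k} → Vec Bool k → Vec ℕ (suc k)
bottomEval j = 1 ∷ Vec.map bit j

-- j_2 + ... + j_{a-1} for a = i + 2.
prefixJ : ∀ {k} → Vec Bool k → Fin k → ℕ
prefixJ {k} j i = sum (map (λ b → if ⌊ b <? i ⌋ then bit (lookup j b) else 0) (allFin k))

-- prod_{a=2}^{n} binom(m_a + j_2 + ... + j_{a-1}, m_a - j_a), with n = k + 1 and a = i + 2.
formula : ∀ {k} → Vec ℕ (suc k) → Vec Bool k → ℕ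
formula {k} m j = product (map (λ i → (lookup m (suc i) + prefixJ j i) C (lookup m (suc i) ∸ bit (lookup j i))) (allFin k))

-- Peel the symbols off in increasing order. Once the symbols below a are removed, every column
-- whose bottom was one of them survives as a loose column: an arbitrary weakly increasing word,
-- its bottom-row constraint being gone. As the bottom row is strictly increasing with evaluation
-- (1, j₂, …, jₙ), there are then 1 + j₂ + ⋯ + j_{a-1} loose columns, plus the column with bottom a
-- when j_a = 1, and the m_a - j_a copies of a outside the bottom row sit at the bottoms of these
-- 1 + j₂ + ⋯ + j_a words in an arbitrary distribution. So a tableau is the same as a weak
-- composition of m_a - j_a into 1 + j₂ + ⋯ + j_a parts for each a, and stars and bars counts these
-- by the binomial coefficients of the formula.

module Submission where

open import Defs

open import Axiom.UniquenessOfIdentityProofs using (module Decidable⇒UIP)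
open import Data.Bool using (Bool; true; false; if_then_else_)
open import Data.Empty using (⊥-elim)
open import Data.Fin as Fin using (Fin; zero; suc; _≟_)
import Data.Fin.Properties as Finₚ
open import Data.Fin.Properties using (_<?_; +↔⊎; *↔×)
open import Data.List using (List; []; _∷_; _++_; map; replicate; filter; length; concat; allFin; tabulate)
open import Data.List.Properties using (length-++; filter-++; map-++; map-∘; ++-assoc; map-tabulate; tabulate-cong)
open import Data.List.NonEmpty using (_∷_; toList)
import Data.List.NonEmpty as List⁺
open import Data.List.Relation.Binary.Permutation.Propositional as ↭
  using (_↭_; ↭-reflexive; module PermutationReasoning)
open import Data.List.Relation.Binary.Permutation.Propositional.Properties
  using (↭-length; filter-↭; shift; ++-comm; ++⁺ʳ)
open import Data.List.Relation.Unary.All as All using (All; []; _∷_)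
import Data.List.Relation.Unary.All.Properties as All
open import Data.List.Relation.Unary.Linked as Linked using (Linked; []; [-]; _∷_)
open import Data.List.Relation.Unary.Linked.Properties using (map⁺; map⁻)
open import Data.Nat as ℕ using (ℕ; zero; suc; _≤_; z≤n; s≤s; s≤s⁻¹; _+_; _∸_; _*_)
open import Data.Nat.Combinatorics using (_C_; nCn≡1; nCk+nC[k+1]≡[n+1]C[k+1])
open import Data.Nat.ListAction using (sum; product)
open import Data.Nat.Properties
  using (<⇒≤; suc-injective; ≤-trans; +-identityʳ; +-suc; +-comm; +-assoc; m+n∸m≡n; m+[n∸m]≡n; m∸n+n≡m;
         ≡-irrelevant)
open import Data.Product using (Σ; _×_; _,_; proj₁; proj₂; uncurry)
open import Data.Product.Function.NonDependent.Propositional using (_×-↔_)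
open import Data.Sum using (_⊎_; inj₁; inj₂)
open import Data.Sum.Function.Propositional using (_⊎-↔_)
open import Data.Vec as Vec using (Vec; lookup)
import Data.Vec.Properties as Vec
open import Data.Vec.Relation.Unary.All as VecAll using () renaming (All to VecAll)
import Data.Vec.Relation.Unary.All.Properties as VecAll
open import Function using (_∘_)
open import Function.Bundles using (_↔_; mk↔ₛ′)
open import Function.Properties.Inverse using (↔-trans)
open import Function.Related.Propositional using (module EquationalReasoning)
open import Relation.Binary.PropositionalEquality
open import Relation.Nullary using (does; yes; no)
open import Relation.Nullary.Decidable using (⌊_⌋)

private
  variable
    n : ℕ

-- Weak compositions

Composition : ℕ → ℕ → Set
Composition N c = Σ (Vec ℕ c) (λ v → Vec.sum v ≡ N)

Composition-≡ : {N c : ℕ} {p q : Composition N c} → proj₁ p ≡ proj₁ q → p ≡ q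
Composition-≡ {p = v , s} {q = .v , s′} refl = cong (v ,_) (≡-irrelevant s s′)

compositionCount : ℕ → ℕ → ℕ
compositionCount zero    zero    = 1
compositionCount (suc N) zero    = 0
compositionCount zero    (suc c) = compositionCount 0 c
compositionCount (suc N) (suc c) = compositionCount (suc N) c + compositionCount N (suc c)

Composition-zero-zero↔ : Composition 0 0 ↔ Fin 1
Composition-zero-zero↔ =
  mk↔ₛ′ (λ _ → zero) (λ _ → Vec.[] , refl) (λ { zero → refl ; (suc ()) }) (λ { (Vec.[] , refl) → refl })

Composition-suc-zero↔ : {N : ℕ} → Composition (suc N) 0 ↔ Fin 0
Composition-suc-zero↔ = mk↔ₛ′ (λ { (Vec.[] , ()) }) (λ ()) (λ ()) (λ { (Vec.[] , ()) })

Composition-zero-suc↔ : {c : ℕ} → Composition 0 (suc c) ↔ Composition 0 c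
Composition-zero-suc↔ = mk↔ₛ′ to (λ (v , s) → 0 Vec.∷ v , s) (λ _ → refl) from-to
  where
  to : Composition 0 (suc _) → Composition 0 _
  to (0 Vec.∷ v , s) = v , s
  from-to : ∀ x → (0 Vec.∷ proj₁ (to x) , proj₂ (to x)) ≡ x
  from-to (0 Vec.∷ v , s) = refl

Composition-suc-suc↔ : {N c : ℕ} →
                       Composition (suc N) (suc c) ↔ (Composition (suc N) c ⊎ Composition N (suc c))
Composition-suc-suc↔ {N} {c} = mk↔ₛ′ to from to-from from-to
  where
  to : Composition (suc N) (suc c) → Composition (suc N) c ⊎ Composition N (suc c)
  to (0     Vec.∷ v , s) = inj₁ (v , s)
  to (suc x Vec.∷ v , s) = inj₂ (x Vec.∷ v , suc-injective s)
  from : Composition (suc N) c ⊎ Composition N (suc c) → Composition (suc N) (suc c)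
  from (inj₁ (v , s))         = 0 Vec.∷ v , s
  from (inj₂ (x Vec.∷ v , s)) = suc x Vec.∷ v , cong suc s
  to-from : ∀ y → to (from y) ≡ y
  to-from (inj₁ _)                 = refl
  to-from (inj₂ (_ Vec.∷ _ , _)) = cong inj₂ (Composition-≡ refl)
  from-to : ∀ x → from (to x) ≡ x
  from-to (0     Vec.∷ _ , _) = refl
  from-to (suc _ Vec.∷ _ , _) = Composition-≡ refl

Composition↔Fin : (N c : ℕ) → Composition N c ↔ Fin (compositionCount N c)
Composition↔Fin zero    zero    = Composition-zero-zero↔
Composition↔Fin (suc N) zero    = Composition-suc-zero↔
Composition↔Fin zero    (suc c) = begin
  Composition 0 (suc c)       ↔⟨ Composition-zero-suc↔ ⟩
  Composition 0 c             ↔⟨ Composition↔Fin 0 c ⟩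
  Fin (compositionCount 0 c)  ∎
  where open EquationalReasoning
Composition↔Fin (suc N) (suc c) = begin
  Composition (suc N) (suc c)
    ↔⟨ Composition-suc-suc↔ ⟩
  (Composition (suc N) c ⊎ Composition N (suc c))
    ↔⟨ Composition↔Fin (suc N) c ⊎-↔ Composition↔Fin N (suc c) ⟩
  (Fin (compositionCount (suc N) c) ⊎ Fin (compositionCount N (suc c)))
    ↔⟨ +↔⊎ ⟨
  Fin (compositionCount (suc N) (suc c))
    ∎
  where open EquationalReasoning

compositionCount-one : (N : ℕ) → compositionCount N 1 ≡ 1
compositionCount-one zero    = refl
compositionCount-one (suc N) = compositionCount-one N

compositionCount≡C : (N c : ℕ) → compositionCount N (suc c) ≡ (N + c) C N
compositionCount≡C zero    zero    = refl
compositionCount≡C zero    (suc c) = compositionCount≡C 0 c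
compositionCount≡C (suc N) zero    = begin
  compositionCount N 1  ≡⟨ compositionCount-one N ⟩
  1                     ≡⟨ nCn≡1 (suc N) ⟨
  suc N C suc N         ≡⟨ cong (_C suc N) (+-identityʳ (suc N)) ⟨
  (suc N + 0) C suc N   ∎
  where open ≡-Reasoning
compositionCount≡C (suc N) (suc c) = begin
  compositionCount (suc N) (suc c) + compositionCount N (suc (suc c))
    ≡⟨ cong₂ _+_ (compositionCount≡C (suc N) c) (compositionCount≡C N (suc c)) ⟩
  (suc N + c) C suc N + (N + suc c) C N
    ≡⟨ cong (λ k → k C suc N + (N + suc c) C N) (+-suc N c) ⟨
  (N + suc c) C suc N + (N + suc c) C N
    ≡⟨ +-comm ((N + suc c) C suc N) _ ⟩
  (N + suc c) C N + (N + suc c) C suc N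
    ≡⟨ nCk+nC[k+1]≡[n+1]C[k+1] (N + suc c) N ⟩
  (suc N + suc c) C suc N ∎
  where open ≡-Reasoning

-- Lowering the alphabet

Sorted : List (Fin n) → Set
Sorted = Linked Fin._≤_

occ-++ : (a : Fin n) (xs ys : List (Fin n)) → occ a (xs ++ ys) ≡ occ a xs + occ a ys
occ-++ a xs ys = trans (cong length (filter-++ (_≟ a) xs ys)) (length-++ (filter (_≟ a) xs))

evalOf-↭ : {xs ys : List (Fin n)} → xs ↭ ys → evalOf xs ≡ evalOf ys
evalOf-↭ xs↭ys = Vec.tabulate-cong (λ a → ↭-length (filter-↭ (_≟ a) xs↭ys))

lower : List (Fin (suc n)) → List (Fin n)
lower []           = []
lower (zero  ∷ xs) = lower xs
lower (suc x ∷ xs) = x ∷ lower xs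

padZeros : ℕ → List (Fin n) → List (Fin (suc n))
padZeros k xs = replicate k zero ++ map suc xs

occ-suc : (a : Fin n) (xs : List (Fin (suc n))) → occ (suc a) xs ≡ occ a (lower xs)
occ-suc a []           = refl
occ-suc a (zero  ∷ xs) = occ-suc a xs
occ-suc a (suc x ∷ xs) with does (x ≟ a)
... | true  = cong suc (occ-suc a xs)
... | false = occ-suc a xs

evalOf-lower : (xs : List (Fin (suc n))) → evalOf xs ≡ occ zero xs Vec.∷ evalOf (lower xs)
evalOf-lower xs = cong (occ zero xs Vec.∷_) (Vec.tabulate-cong (λ a → occ-suc a xs))

lower-++ : (xs ys : List (Fin (suc n))) → lower (xs ++ ys) ≡ lower xs ++ lower ys
lower-++ []           ys = refl
lower-++ (zero  ∷ xs) ys = lower-++ xs ys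
lower-++ (suc x ∷ xs) ys = cong (x ∷_) (lower-++ xs ys)

lower-map-suc : (xs : List (Fin n)) → lower (map suc xs) ≡ xs
lower-map-suc []       = refl
lower-map-suc (x ∷ xs) = cong (x ∷_) (lower-map-suc xs)

occ-zero-map-suc : (xs : List (Fin n)) → occ zero (map suc xs) ≡ 0
occ-zero-map-suc []       = refl
occ-zero-map-suc (x ∷ xs) = occ-zero-map-suc xs

map-suc-lower : (xs : List (Fin (suc n))) → occ zero xs ≡ 0 → map suc (lower xs) ≡ xs
map-suc-lower []           _ = refl
map-suc-lower (suc x ∷ xs) p = cong (suc x ∷_) (map-suc-lower xs p)

lower-padZeros : (k : ℕ) (xs : List (Fin n)) → lower (padZeros k xs) ≡ xs
lower-padZeros zero    xs = lower-map-suc xs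
lower-padZeros (suc k) xs = lower-padZeros k xs

occ-zero-padZeros : (k : ℕ) (xs : List (Fin n)) → occ zero (padZeros k xs) ≡ k
occ-zero-padZeros zero    xs = occ-zero-map-suc xs
occ-zero-padZeros (suc k) xs = cong suc (occ-zero-padZeros k xs)

occ-zero-replicate : (k : ℕ) (xs : List (Fin (suc n))) → occ zero (replicate k zero ++ xs) ≡ k + occ zero xs
occ-zero-replicate zero    xs = refl
occ-zero-replicate (suc k) xs = cong suc (occ-zero-replicate k xs)

lower-replicate : (k : ℕ) (xs : List (Fin (suc n))) → lower (replicate k zero ++ xs) ≡ lower xs
lower-replicate zero    xs = refl
lower-replicate (suc k) xs = lower-replicate k xs

evalOf-padZeros : (k : ℕ) (xs : List (Fin n)) → evalOf (padZeros k xs) ≡ k Vec.∷ evalOf xs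
evalOf-padZeros k xs = trans (evalOf-lower (padZeros k xs))
  (cong₂ Vec._∷_ (occ-zero-padZeros k xs) (cong evalOf (lower-padZeros k xs)))

zero∷-sorted : {xs : List (Fin (suc n))} → Sorted xs → Sorted (zero ∷ xs)
zero∷-sorted {xs = []}    _ = [-]
zero∷-sorted {xs = _ ∷ _} p = z≤n ∷ p

map-suc-sorted : {xs : List (Fin n)} → Sorted xs → Sorted (map suc xs)
map-suc-sorted p = map⁺ (Linked.map s≤s p)

map-suc-sorted⁻ : {xs : List (Fin n)} → Sorted (map suc xs) → Sorted xs
map-suc-sorted⁻ p = Linked.map s≤s⁻¹ (map⁻ p)

map-suc-strict : {xs : List (Fin n)} → Linked Fin._<_ xs → Linked Fin._<_ (map suc xs)
map-suc-strict p = map⁺ (Linked.map s≤s p)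

map-suc-strict⁻ : {xs : List (Fin n)} → Linked Fin._<_ (map suc xs) → Linked Fin._<_ xs
map-suc-strict⁻ p = Linked.map s≤s⁻¹ (map⁻ p)

occ-zero-sorted-suc : {a : Fin n} {xs : List (Fin (suc n))} → Sorted (suc a ∷ xs) → occ zero xs ≡ 0
occ-zero-sorted-suc {xs = []}         _       = refl
occ-zero-sorted-suc {xs = suc _ ∷ _}  (_ ∷ p) = occ-zero-sorted-suc p

padZeros-occ-lower : (xs : List (Fin (suc n))) → Sorted xs → padZeros (occ zero xs) (lower xs) ≡ xs
padZeros-occ-lower []           _ = refl
padZeros-occ-lower (zero  ∷ xs) p = cong (zero ∷_) (padZeros-occ-lower xs (Linked.tail p))
padZeros-occ-lower (suc x ∷ xs) p rewrite occ-zero-sorted-suc p =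
  cong (suc x ∷_) (map-suc-lower xs (occ-zero-sorted-suc p))

padZeros-sorted : (k : ℕ) {xs : List (Fin n)} → Sorted xs → Sorted (padZeros k xs)
padZeros-sorted zero    p = map-suc-sorted p
padZeros-sorted (suc k) p = zero∷-sorted (padZeros-sorted k p)

padZeros-sorted⁻ : (k : ℕ) {xs : List (Fin n)} → Sorted (padZeros k xs) → Sorted xs
padZeros-sorted⁻ zero    p = map-suc-sorted⁻ p
padZeros-sorted⁻ (suc k) p = padZeros-sorted⁻ k (Linked.tail p)

lower-sorted : {xs : List (Fin (suc n))} → Sorted xs → Sorted (lower xs)
lower-sorted {xs = xs} p = padZeros-sorted⁻ (occ zero xs) (subst Sorted (sym (padZeros-occ-lower xs p)) p)

map-occ-zero-padZeros : {r : ℕ} (v : Vec ℕ r) (F : Vec (List (Fin n)) r) →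
                        Vec.map (occ zero) (Vec.zipWith padZeros v F) ≡ v
map-occ-zero-padZeros Vec.[]      Vec.[]      = refl
map-occ-zero-padZeros (k Vec.∷ v) (ℓ Vec.∷ F) = cong₂ Vec._∷_ (occ-zero-padZeros k ℓ) (map-occ-zero-padZeros v F)

map-lower-padZeros : {r : ℕ} (v : Vec ℕ r) (F : Vec (List (Fin n)) r) →
                     Vec.map lower (Vec.zipWith padZeros v F) ≡ F
map-lower-padZeros Vec.[]      Vec.[]      = refl
map-lower-padZeros (k Vec.∷ v) (ℓ Vec.∷ F) = cong₂ Vec._∷_ (lower-padZeros k ℓ) (map-lower-padZeros v F)

zipWith-padZeros-sorted : {r : ℕ} (v : Vec ℕ r) {F : Vec (List (Fin n)) r} →
                          VecAll Sorted F → VecAll Sorted (Vec.zipWith padZeros v F)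
zipWith-padZeros-sorted Vec.[]      VecAll.[]       = VecAll.[]
zipWith-padZeros-sorted (k Vec.∷ v) (s VecAll.∷ ss) = padZeros-sorted k s VecAll.∷ zipWith-padZeros-sorted v ss

zipWith-padZeros-occ-lower : {r : ℕ} {L : Vec (List (Fin (suc n))) r} → VecAll Sorted L →
                             Vec.zipWith padZeros (Vec.map (occ zero) L) (Vec.map lower L) ≡ L
zipWith-padZeros-occ-lower VecAll.[]                = refl
zipWith-padZeros-occ-lower {L = ℓ Vec.∷ _} (s VecAll.∷ ss) =
  cong₂ Vec._∷_ (padZeros-occ-lower ℓ s) (zipWith-padZeros-occ-lower ss)

raiseColumn : Column n → Column (suc n)
raiseColumn = List⁺.map suc

lowerColumns : Filling (suc n) → Filling n
lowerColumns []                 = []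
lowerColumns ((zero  ∷ _) ∷ T) = lowerColumns T
lowerColumns ((suc a ∷ ℓ) ∷ T) = (a ∷ lower ℓ) ∷ lowerColumns T

lowerColumns-raise : (B : Filling n) → lowerColumns (map raiseColumn B) ≡ B
lowerColumns-raise []            = refl
lowerColumns-raise ((a ∷ ℓ) ∷ B) = cong₂ _∷_ (cong (a ∷_) (lower-map-suc ℓ)) (lowerColumns-raise B)

raise-lowerColumns : (T : Filling (suc n)) → All (Sorted ∘ toList) T → occ zero (bottomRow T) ≡ 0 →
                     map raiseColumn (lowerColumns T) ≡ T
raise-lowerColumns []                _        _ = refl
raise-lowerColumns ((suc a ∷ ℓ) ∷ T) (s ∷ ss) z =
  cong₂ _∷_ (cong (suc a ∷_) (map-suc-lower ℓ (occ-zero-sorted-suc s))) (raise-lowerColumns T ss z)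

entries-raise : (B : Filling n) → entries (map raiseColumn B) ≡ map suc (entries B)
entries-raise []      = refl
entries-raise (c ∷ B) = trans (cong (map suc (toList c) ++_) (entries-raise B)) (sym (map-++ suc (toList c) (entries B)))

bottomRow-raise : (B : Filling n) → bottomRow (map raiseColumn B) ≡ map suc (bottomRow B)
bottomRow-raise B = trans (sym (map-∘ B)) (map-∘ B)

zero∷-bottomRow-raise : (B : Filling n) → Linked Fin._<_ (bottomRow (map raiseColumn B)) →
                        Linked Fin._<_ (zero ∷ bottomRow (map raiseColumn B))
zero∷-bottomRow-raise []      _ = [-]
zero∷-bottomRow-raise (_ ∷ _) p = s≤s z≤n ∷ p

raise-IsRPS : {B : Filling n} → IsRPS B → IsRPS (map raiseColumn B)
raise-IsRPS {B = B} (cols , bottom) =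
  All.map⁺ (All.map map-suc-sorted cols) , subst (Linked Fin._<_) (sym (bottomRow-raise B)) (map-suc-strict bottom)

raise-IsRPS⁻ : {B : Filling n} → IsRPS (map raiseColumn B) → IsRPS B
raise-IsRPS⁻ {B = B} (cols , bottom) =
  All.map map-suc-sorted⁻ (All.map⁻ cols) , map-suc-strict⁻ (subst (Linked Fin._<_) (bottomRow-raise B) bottom)

-- Open tableaux

looseEntries : {A : Set} {r : ℕ} → Vec (List A) r → List A
looseEntries = concat ∘ Vec.toList

-- The state reached after the symbols below some a have been peeled off: r loose columns,
-- the upper parts of columns whose bottoms were already removed (sorted, possibly empty words),
-- and an rps filling over the remaining symbols, relabelled so that a becomes zero.
record IsOpenTableau {n r : ℕ} (m : Vec ℕ n) (e : Vec Bool n) (FT : Vec (List (Fin n)) r × Filling n) : Set where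
  constructor isOpenTableau
  field
    looseSorted      : VecAll Sorted (proj₁ FT)
    rps              : IsRPS (proj₂ FT)
    evaluation       : evalOf (looseEntries (proj₁ FT) ++ entries (proj₂ FT)) ≡ m
    bottomEvaluation : evalOf (bottomRow (proj₂ FT)) ≡ Vec.map bit e

open IsOpenTableau

OpenTableau : (n r : ℕ) → Vec ℕ n → Vec Bool n → Set
OpenTableau n r m e = Σ (Vec (List (Fin n)) r × Filling n) (IsOpenTableau m e)

IsOpenTableau-irrelevant : {r : ℕ} {m : Vec ℕ n} {e : Vec Bool n} {FT : Vec (List (Fin n)) r × Filling n}
                           (p q : IsOpenTableau m e FT) → p ≡ q
IsOpenTableau-irrelevant (isOpenTableau s (c , d) v w) (isOpenTableau s′ (c′ , d′) v′ w′)
  rewrite VecAll.irrelevant (Linked.irrelevant Finₚ.≤-irrelevant) s s′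
        | All.irrelevant (Linked.irrelevant Finₚ.≤-irrelevant) c c′
        | Linked.irrelevant Finₚ.<-irrelevant d d′
        | Decidable⇒UIP.≡-irrelevant (Vec.≡-dec ℕ._≟_) v v′
        | Decidable⇒UIP.≡-irrelevant (Vec.≡-dec ℕ._≟_) w w′ = refl

OpenTableau-≡ : {r : ℕ} {m : Vec ℕ n} {e : Vec Bool n} {s t : OpenTableau n r m e} →
                proj₁ s ≡ proj₁ t → s ≡ t
OpenTableau-≡ {s = FT , p} {t = .FT , q} refl = cong (FT ,_) (IsOpenTableau-irrelevant p q)

occ-looseEntries : {r : ℕ} (a : Fin n) (L : Vec (List (Fin n)) r) →
                   occ a (looseEntries L) ≡ Vec.sum (Vec.map (occ a) L)
occ-looseEntries a Vec.[]      = refl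
occ-looseEntries a (ℓ Vec.∷ L) = trans (occ-++ a ℓ (looseEntries L)) (cong (occ a ℓ +_) (occ-looseEntries a L))

lower-looseEntries : {r : ℕ} (L : Vec (List (Fin (suc n))) r) →
                     lower (looseEntries L) ≡ looseEntries (Vec.map lower L)
lower-looseEntries Vec.[]      = refl
lower-looseEntries (ℓ Vec.∷ L) = trans (lower-++ ℓ (looseEntries L)) (cong (lower ℓ ++_) (lower-looseEntries L))

-- The symbol zero occurs in the bottom row iff b; it is then the bottom of the first column,
-- whose upper part is the first loose column of L.
attach : (b : Bool) {r : ℕ} → Vec (List (Fin (suc n))) (bit b + r) → Filling n →
         Vec (List (Fin (suc n))) r × Filling (suc n)
attach true  (ℓ Vec.∷ L) B = L , (zero ∷ ℓ) ∷ map raiseColumn B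
attach false L           B = L , map raiseColumn B

detach : (b : Bool) {r : ℕ} → Vec (List (Fin (suc n))) r → Filling (suc n) →
         Vec (List (Fin (suc n))) (bit b + r) × Filling n
detach true  F []            = [] Vec.∷ F , []  -- excluded by the bottom evaluation
detach true  F ((_ ∷ ℓ) ∷ T) = ℓ Vec.∷ F , lowerColumns T
detach false F T             = F , lowerColumns T

detach-attach : (b : Bool) {r : ℕ} (L : Vec (List (Fin (suc n))) (bit b + r)) (B : Filling n) →
                uncurry (detach b) (attach b L B) ≡ (L , B)
detach-attach true  (ℓ Vec.∷ L) B = cong (ℓ Vec.∷ L ,_) (lowerColumns-raise B)
detach-attach false L           B = cong (L ,_) (lowerColumns-raise B)

attach-detach : (b : Bool) {r : ℕ} (F : Vec (List (Fin (suc n))) r) (T : Filling (suc n)) →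
                IsRPS T → occ zero (bottomRow T) ≡ bit b → uncurry (attach b) (detach b F T) ≡ (F , T)
attach-detach false F T (cols , _) zeros = cong (F ,_) (raise-lowerColumns T cols zeros)
attach-detach true F ((zero ∷ ℓ) ∷ T) (_ ∷ cols , _) zeros =
  cong (λ T′ → F , (zero ∷ ℓ) ∷ T′) (raise-lowerColumns T cols (suc-injective zeros))
attach-detach true F ((suc a ∷ ℓ) ∷ T) (_ , bottom) zeros
  with () ← trans (sym zeros) (occ-zero-sorted-suc (Linked.map <⇒≤ bottom))

attach-entries : (b : Bool) {r : ℕ} (L : Vec (List (Fin (suc n))) (bit b + r)) (B : Filling n) →
                 let (F , T) = attach b L B in
                 looseEntries F ++ entries T ↭ replicate (bit b) zero ++ looseEntries L ++ map suc (entries B)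
attach-entries false L B = ↭-reflexive (cong (looseEntries L ++_) (entries-raise B))
attach-entries true (ℓ Vec.∷ F) B = begin
  looseEntries F ++ zero ∷ ℓ ++ entries (map raiseColumn B)
    ≡⟨ cong (λ E′ → looseEntries F ++ zero ∷ ℓ ++ E′) (entries-raise B) ⟩
  looseEntries F ++ zero ∷ ℓ ++ E
    ↭⟨ shift zero (looseEntries F) (ℓ ++ E) ⟩
  zero ∷ looseEntries F ++ ℓ ++ E
    ≡⟨ cong (zero ∷_) (sym (++-assoc (looseEntries F) ℓ E)) ⟩
  zero ∷ (looseEntries F ++ ℓ) ++ E
    ↭⟨ ↭.prep zero (++⁺ʳ E (++-comm (looseEntries F) ℓ)) ⟩
  zero ∷ (ℓ ++ looseEntries F) ++ E
    ∎
  where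
  open PermutationReasoning
  E : List (Fin (suc _))
  E = map suc (entries B)

attach-evalOf : (b : Bool) {r : ℕ} (L : Vec (List (Fin (suc n))) (bit b + r)) (B : Filling n) →
                let (F , T) = attach b L B in
                evalOf (looseEntries F ++ entries T) ≡
                (bit b + occ zero (looseEntries L)) Vec.∷ evalOf (looseEntries (Vec.map lower L) ++ entries B)
attach-evalOf b {r} L B = begin
  evalOf (looseEntries F ++ entries T)          ≡⟨ evalOf-↭ (attach-entries b L B) ⟩
  evalOf (replicate (bit b) zero ++ X)          ≡⟨ evalOf-lower (replicate (bit b) zero ++ X) ⟩
  occ zero (replicate (bit b) zero ++ X) Vec.∷ evalOf (lower (replicate (bit b) zero ++ X))
    ≡⟨ cong₂ Vec._∷_ (trans (occ-zero-replicate (bit b) X) (cong (bit b +_) occ-zero-X))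
                     (cong evalOf (trans (lower-replicate (bit b) X) lower-X)) ⟩
  (bit b + occ zero (looseEntries L)) Vec.∷ evalOf (looseEntries (Vec.map lower L) ++ entries B) ∎
  where
  open ≡-Reasoning
  F : Vec (List (Fin (suc _))) r
  F = proj₁ (attach b L B)
  T : Filling (suc _)
  T = proj₂ (attach b L B)
  X : List (Fin (suc _))
  X = looseEntries L ++ map suc (entries B)
  occ-zero-X : occ zero X ≡ occ zero (looseEntries L)
  occ-zero-X = begin
    occ zero X                                               ≡⟨ occ-++ zero (looseEntries L) _ ⟩
    occ zero (looseEntries L) + occ zero (map suc (entries B)) ≡⟨ cong (_ +_) (occ-zero-map-suc (entries B)) ⟩
    occ zero (looseEntries L) + 0                            ≡⟨ +-identityʳ _ ⟩
    occ zero (looseEntries L)                                ∎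
  lower-X : lower X ≡ looseEntries (Vec.map lower L) ++ entries B
  lower-X = trans (lower-++ (looseEntries L) _) (cong₂ _++_ (lower-looseEntries L) (lower-map-suc (entries B)))

attach-bottomRow : (b : Bool) {r : ℕ} (L : Vec (List (Fin (suc n))) (bit b + r)) (B : Filling n) →
                   bottomRow (proj₂ (attach b L B)) ≡ padZeros (bit b) (bottomRow B)
attach-bottomRow true  (_ Vec.∷ _) B = cong (zero ∷_) (bottomRow-raise B)
attach-bottomRow false L           B = bottomRow-raise B

evalOf-attach-bottomRow : (b : Bool) {r : ℕ} (L : Vec (List (Fin (suc n))) (bit b + r)) (B : Filling n) →
                          evalOf (bottomRow (proj₂ (attach b L B))) ≡ bit b Vec.∷ evalOf (bottomRow B)
evalOf-attach-bottomRow b L B = trans (cong evalOf (attach-bottomRow b L B)) (evalOf-padZeros (bit b) (bottomRow B))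

attach-sorted : (b : Bool) {r : ℕ} (L : Vec (List (Fin (suc n))) (bit b + r)) (B : Filling n) →
                VecAll Sorted L → IsRPS B →
                let (F , T) = attach b L B in VecAll Sorted F × IsRPS T
attach-sorted false L B sorted rps = sorted , raise-IsRPS rps
attach-sorted true (ℓ Vec.∷ L) B (s VecAll.∷ sorted) rps with raise-IsRPS rps
... | cols , bottom = sorted , zero∷-sorted s ∷ cols , zero∷-bottomRow-raise B bottom

attach-sorted⁻ : (b : Bool) {r : ℕ} (L : Vec (List (Fin (suc n))) (bit b + r)) (B : Filling n) →
                 let (F , T) = attach b L B in VecAll Sorted F × IsRPS T →
                 VecAll Sorted L × IsRPS B
attach-sorted⁻ false L B (sorted , rps) = sorted , raise-IsRPS⁻ rps
attach-sorted⁻ true (ℓ Vec.∷ L) B (sorted , s ∷ cols , bottom) =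
  Linked.tail s VecAll.∷ sorted , raise-IsRPS⁻ (cols , Linked.tail bottom)

module _ {r : ℕ} {m₀ : ℕ} {m : Vec ℕ n} {b : Bool} {e : Vec Bool n}
         (L : Vec (List (Fin (suc n))) (bit b + r)) (B : Filling n) where

  IsOpenTableau-attach⁻ : IsOpenTableau (m₀ Vec.∷ m) (b Vec.∷ e) (attach b L B) →
                          VecAll Sorted L × Vec.sum (Vec.map (occ zero) L) ≡ m₀ ∸ bit b ×
                          IsOpenTableau m e (Vec.map lower L , B)
  IsOpenTableau-attach⁻ p = sortedL , zeroCount ,
    isOpenTableau (VecAll.map⁺ (VecAll.map lower-sorted sortedL)) rpsB
                  (Vec.∷-injectiveʳ evalParts) (Vec.∷-injectiveʳ bottomParts)
    where
    sortedL : VecAll Sorted L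
    sortedL = proj₁ (attach-sorted⁻ b L B (looseSorted p , rps p))
    rpsB : IsRPS B
    rpsB = proj₂ (attach-sorted⁻ b L B (looseSorted p , rps p))
    evalParts : (bit b + occ zero (looseEntries L)) Vec.∷ evalOf (looseEntries (Vec.map lower L) ++ entries B) ≡
                m₀ Vec.∷ m
    evalParts = trans (sym (attach-evalOf b L B)) (evaluation p)
    bottomParts : bit b Vec.∷ evalOf (bottomRow B) ≡ bit b Vec.∷ Vec.map bit e
    bottomParts = trans (sym (evalOf-attach-bottomRow b L B)) (bottomEvaluation p)
    zeroCount : Vec.sum (Vec.map (occ zero) L) ≡ m₀ ∸ bit b
    zeroCount = begin
      Vec.sum (Vec.map (occ zero) L)              ≡⟨ occ-looseEntries zero L ⟨
      occ zero (looseEntries L)                   ≡⟨ m+n∸m≡n (bit b) _ ⟨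
      bit b + occ zero (looseEntries L) ∸ bit b   ≡⟨ cong (_∸ bit b) (Vec.∷-injectiveˡ evalParts) ⟩
      m₀ ∸ bit b                                  ∎
      where open ≡-Reasoning

  IsOpenTableau-attach⁺ : bit b ≤ m₀ → VecAll Sorted L → Vec.sum (Vec.map (occ zero) L) ≡ m₀ ∸ bit b →
                          IsOpenTableau m e (Vec.map lower L , B) →
                          IsOpenTableau (m₀ Vec.∷ m) (b Vec.∷ e) (attach b L B)
  IsOpenTableau-attach⁺ b≤m₀ sortedL zeroCount q = isOpenTableau
    (proj₁ (attach-sorted b L B sortedL (rps q))) (proj₂ (attach-sorted b L B sortedL (rps q)))
    (trans (attach-evalOf b L B) (cong₂ Vec._∷_ zeros (evaluation q)))
    (trans (evalOf-attach-bottomRow b L B) (cong (bit b Vec.∷_) (bottomEvaluation q)))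
    where
    zeros : bit b + occ zero (looseEntries L) ≡ m₀
    zeros = trans (cong (bit b +_) (trans (occ-looseEntries zero L) zeroCount)) (m+[n∸m]≡n b≤m₀)

module _ {r m₀ : ℕ} {m : Vec ℕ n} {b : Bool} {e : Vec Bool n} (b≤m₀ : bit b ≤ m₀) where

  private
    Source Target : Set
    Source = OpenTableau (suc n) r (m₀ Vec.∷ m) (b Vec.∷ e)
    Target = Composition (m₀ ∸ bit b) (bit b + r) × OpenTableau n (bit b + r) m e

    detached : Source → Vec (List (Fin (suc n))) (bit b + r) × Filling n
    detached ((F , T) , _) = detach b F T

    attach-detached : (x : Source) → uncurry (attach b) (detached x) ≡ proj₁ x
    attach-detached ((F , T) , p) = attach-detach b F T (rps p) (cong Vec.head (bottomEvaluation p))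

    detached-valid : (x : Source) → let (L , B) = detached x in
                     VecAll Sorted L × Vec.sum (Vec.map (occ zero) L) ≡ m₀ ∸ bit b ×
                     IsOpenTableau m e (Vec.map lower L , B)
    detached-valid x = IsOpenTableau-attach⁻ _ _ (subst (IsOpenTableau _ _) (sym (attach-detached x)) (proj₂ x))

    peel : Source → Target
    peel x =
      let (L , B) = detached x
          (_ , zeroCount , valid) = detached-valid x
      in (Vec.map (occ zero) L , zeroCount) , (Vec.map lower L , B) , valid

    unpeel : Target → Source
    unpeel ((v , sum≡) , (F , B) , q) = attach b L B , IsOpenTableau-attach⁺ L B b≤m₀
      (zipWith-padZeros-sorted v (looseSorted q))
      (trans (cong Vec.sum (map-occ-zero-padZeros v F)) sum≡)
      (subst (λ F′ → IsOpenTableau m e (F′ , B)) (sym (map-lower-padZeros v F)) q)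
      where
      L : Vec (List (Fin (suc n))) (bit b + r)
      L = Vec.zipWith padZeros v F

    peel-unpeel : (y : Target) → peel (unpeel y) ≡ y
    peel-unpeel ((v , _) , (F , B) , _) = cong₂ _,_
      (Composition-≡ (trans (cong (Vec.map (occ zero) ∘ proj₁) detach-attach′) (map-occ-zero-padZeros v F)))
      (OpenTableau-≡ (cong₂ _,_ (trans (cong (Vec.map lower ∘ proj₁) detach-attach′) (map-lower-padZeros v F))
                                (cong proj₂ detach-attach′)))
      where
      detach-attach′ : uncurry (detach b) (attach b (Vec.zipWith padZeros v F) B) ≡ (Vec.zipWith padZeros v F , B)
      detach-attach′ = detach-attach b (Vec.zipWith padZeros v F) B

    unpeel-peel : (x : Source) → unpeel (peel x) ≡ x
    unpeel-peel x = OpenTableau-≡ (let (L , B) = detached x in begin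
      attach b (Vec.zipWith padZeros (Vec.map (occ zero) L) (Vec.map lower L)) B
        ≡⟨ cong (λ L′ → attach b L′ B) (zipWith-padZeros-occ-lower (proj₁ (detached-valid x))) ⟩
      attach b L B
        ≡⟨ attach-detached x ⟩
      proj₁ x ∎)
      where open ≡-Reasoning

  peel↔ : OpenTableau (suc n) r (m₀ Vec.∷ m) (b Vec.∷ e) ↔
          (Composition (m₀ ∸ bit b) (bit b + r) × OpenTableau n (bit b + r) m e)
  peel↔ = mk↔ₛ′ peel unpeel peel-unpeel unpeel-peel

openTableauCount : {n : ℕ} → ℕ → Vec ℕ n → Vec Bool n → ℕ
openTableauCount r Vec.[]       Vec.[]      = 1
openTableauCount r (m₀ Vec.∷ m) (b Vec.∷ e) =
  compositionCount (m₀ ∸ bit b) (bit b + r) * openTableauCount (bit b + r) m e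

Fin0-lists≡replicate : {r : ℕ} (F : Vec (List (Fin 0)) r) → F ≡ Vec.replicate r []
Fin0-lists≡replicate Vec.[]        = refl
Fin0-lists≡replicate ([] Vec.∷ F) = cong ([] Vec.∷_) (Fin0-lists≡replicate F)

OpenTableau-zero↔ : {r : ℕ} → OpenTableau 0 r Vec.[] Vec.[] ↔ Fin 1
OpenTableau-zero↔ {r} = mk↔ₛ′ (λ _ → zero) (λ _ → empty) (λ { zero → refl ; (suc ()) }) empty-unique
  where
  empty : OpenTableau 0 r Vec.[] Vec.[]
  empty = (Vec.replicate r [] , []) ,
          isOpenTableau (VecAll.universal (λ { [] → [] ; (() ∷ _) }) _) ([] , []) refl refl
  empty-unique : ∀ x → empty ≡ x
  empty-unique ((F , []) , _) = OpenTableau-≡ (cong (_, []) (sym (Fin0-lists≡replicate F)))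

OpenTableau↔Fin : {n r : ℕ} (m : Vec ℕ n) (e : Vec Bool n) → (∀ a → bit (lookup e a) ≤ lookup m a) →
                  OpenTableau n r m e ↔ Fin (openTableauCount r m e)
OpenTableau↔Fin Vec.[] Vec.[] _ = OpenTableau-zero↔
OpenTableau↔Fin {r = r} (m₀ Vec.∷ m) (b Vec.∷ e) bit≤m = begin
  OpenTableau _ r (m₀ Vec.∷ m) (b Vec.∷ e)
    ↔⟨ peel↔ (bit≤m zero) ⟩
  (Composition (m₀ ∸ bit b) (bit b + r) × OpenTableau _ (bit b + r) m e)
    ↔⟨ Composition↔Fin _ _ ×-↔ OpenTableau↔Fin m e (bit≤m ∘ suc) ⟩
  (Fin (compositionCount (m₀ ∸ bit b) (bit b + r)) × Fin (openTableauCount (bit b + r) m e))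
    ↔⟨ *↔× ⟨
  Fin (openTableauCount r (m₀ Vec.∷ m) (b Vec.∷ e)) ∎
  where open EquationalReasoning

-- The product formula

sum-map-≡0 : {A : Set} (f : A → ℕ) → (∀ x → f x ≡ 0) → (xs : List A) → sum (map f xs) ≡ 0
sum-map-≡0 f f≡0 []       = refl
sum-map-≡0 f f≡0 (x ∷ xs) = cong₂ _+_ (f≡0 x) (sum-map-≡0 f f≡0 xs)

prefixJ-zero : {k : ℕ} (b : Bool) (j : Vec Bool k) → prefixJ (b Vec.∷ j) zero ≡ 0
prefixJ-zero {k} b j = sum-map-≡0 _ (λ _ → refl) (allFin (suc k))

suc<?suc : {k : ℕ} (x i : Fin k) → ⌊ suc x <? suc i ⌋ ≡ ⌊ x <? i ⌋
suc<?suc x i with x <? i | suc x <? suc i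
... | yes _   | yes _   = refl
... | no _    | no _    = refl
... | yes x<i | no sx≮si = ⊥-elim (sx≮si (s≤s x<i))
... | no x≮i  | yes sx<si = ⊥-elim (x≮i (s≤s⁻¹ sx<si))

prefixJ-suc : {k : ℕ} (b : Bool) (j : Vec Bool k) (i : Fin k) → prefixJ (b Vec.∷ j) (suc i) ≡ bit b + prefixJ j i
prefixJ-suc {k} b j i = cong (bit b +_) (begin
  sum (map term (tabulate suc)) ≡⟨ cong sum (map-tabulate suc term) ⟩
  sum (tabulate (term ∘ suc))   ≡⟨ cong sum (tabulate-cong (λ x → cong (λ t → if t then bit (lookup j x) else 0)
                                                                        (suc<?suc x i))) ⟩
  sum (tabulate term′)          ≡⟨ cong sum (map-tabulate (λ x → x) term′) ⟨
  prefixJ j i                   ∎)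
  where
  open ≡-Reasoning
  term : Fin (suc k) → ℕ
  term x = if ⌊ x <? suc i ⌋ then bit (lookup (b Vec.∷ j) x) else 0
  term′ : Fin k → ℕ
  term′ x = if ⌊ x <? i ⌋ then bit (lookup j x) else 0

compositionCount-peeled : (x d r : ℕ) → d ≤ x → compositionCount (x ∸ d) (d + suc r) ≡ (x + r) C (x ∸ d)
compositionCount-peeled x d r d≤x = begin
  compositionCount (x ∸ d) (d + suc r)   ≡⟨ cong (compositionCount (x ∸ d)) (+-suc d r) ⟩
  compositionCount (x ∸ d) (suc (d + r)) ≡⟨ compositionCount≡C (x ∸ d) (d + r) ⟩
  (x ∸ d + (d + r)) C (x ∸ d)            ≡⟨ cong (_C (x ∸ d)) (+-assoc (x ∸ d) d r) ⟨
  (x ∸ d + d + r) C (x ∸ d)              ≡⟨ cong (λ t → (t + r) C (x ∸ d)) (m∸n+n≡m d≤x) ⟩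
  (x + r) C (x ∸ d)                      ∎
  where open ≡-Reasoning

binomialProduct : {k : ℕ} → ℕ → Vec ℕ k → Vec Bool k → ℕ
binomialProduct {k} r m j =
  product (map (λ i → (lookup m i + (r + prefixJ j i)) C (lookup m i ∸ bit (lookup j i))) (allFin k))

openTableauCount≡binomialProduct : {k : ℕ} (r : ℕ) (m : Vec ℕ k) (j : Vec Bool k) →
                                   (∀ i → bit (lookup j i) ≤ lookup m i) →
                                   openTableauCount (suc r) m j ≡ binomialProduct r m j
openTableauCount≡binomialProduct r Vec.[] Vec.[] _ = refl
openTableauCount≡binomialProduct r (x Vec.∷ m) (b Vec.∷ j) bit≤m = cong₂ _*_ first rest
  where
  open ≡-Reasoning
  factor : Fin _ → ℕ
  factor i = (lookup (x Vec.∷ m) i + (r + prefixJ (b Vec.∷ j) i))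
             C (lookup (x Vec.∷ m) i ∸ bit (lookup (b Vec.∷ j) i))
  first : compositionCount (x ∸ bit b) (bit b + suc r) ≡ factor zero
  first = begin
    compositionCount (x ∸ bit b) (bit b + suc r) ≡⟨ compositionCount-peeled x (bit b) r (bit≤m zero) ⟩
    (x + r) C (x ∸ bit b)                        ≡⟨ cong (λ t → (x + t) C (x ∸ bit b)) (+-identityʳ r) ⟨
    (x + (r + 0)) C (x ∸ bit b)                  ≡⟨ cong (λ t → (x + (r + t)) C (x ∸ bit b)) (prefixJ-zero b j) ⟨
    factor zero                                  ∎
  factor′ : Fin _ → ℕ
  factor′ i = (lookup m i + (bit b + r + prefixJ j i)) C (lookup m i ∸ bit (lookup j i))
  shifted : ∀ i → factor (suc i) ≡ factor′ i
  shifted i = cong (λ t → (lookup m i + t) C (lookup m i ∸ bit (lookup j i))) (begin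
    r + prefixJ (b Vec.∷ j) (suc i) ≡⟨ cong (r +_) (prefixJ-suc b j i) ⟩
    r + (bit b + prefixJ j i)       ≡⟨ +-assoc r (bit b) _ ⟨
    r + bit b + prefixJ j i         ≡⟨ cong (_+ prefixJ j i) (+-comm r (bit b)) ⟩
    bit b + r + prefixJ j i         ∎)
  rest : openTableauCount (bit b + suc r) m j ≡ product (map factor (tabulate suc))
  rest = begin
    openTableauCount (bit b + suc r) m j   ≡⟨ cong (λ t → openTableauCount t m j) (+-suc (bit b) r) ⟩
    openTableauCount (suc (bit b + r)) m j ≡⟨ openTableauCount≡binomialProduct (bit b + r) m j (bit≤m ∘ suc) ⟩
    binomialProduct (bit b + r) m j        ≡⟨ cong product (map-tabulate (λ i → i) factor′) ⟩
    product (tabulate factor′)             ≡⟨ cong product (tabulate-cong shifted) ⟨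
    product (tabulate (factor ∘ suc))      ≡⟨ cong product (map-tabulate suc factor) ⟨
    product (map factor (tabulate suc))    ∎

bit≤1 : (b : Bool) → bit b ≤ 1
bit≤1 true  = s≤s z≤n
bit≤1 false = z≤n

openTableauCount≡formula : {k : ℕ} (m : Vec ℕ (suc k)) (j : Vec Bool k) → (∀ a → 1 ≤ lookup m a) →
                           openTableauCount 0 m (true Vec.∷ j) ≡ formula m j
openTableauCount≡formula (m₀ Vec.∷ m) j pos = begin
  compositionCount (m₀ ∸ 1) 1 * openTableauCount 1 m j
    ≡⟨ cong (_* openTableauCount 1 m j) (compositionCount-one (m₀ ∸ 1)) ⟩
  openTableauCount 1 m j + 0
    ≡⟨ +-identityʳ _ ⟩
  openTableauCount 1 m j
    ≡⟨ openTableauCount≡binomialProduct 0 m j (λ i → ≤-trans (bit≤1 (lookup j i)) (pos (suc i))) ⟩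
  formula (m₀ Vec.∷ m) j
    ∎
  where open ≡-Reasoning

RPSTableau↔OpenTableau : {n : ℕ} (m : Vec ℕ (suc n)) (j : Vec Bool n) →
                         RPSTableau (suc n) m (bottomEval j) ↔ OpenTableau (suc n) 0 m (true Vec.∷ j)
RPSTableau↔OpenTableau m j =
  mk↔ₛ′ to from (λ { ((Vec.[] , _) , isOpenTableau VecAll.[] _ _ _) → refl }) (λ _ → refl)
  where
  to : RPSTableau _ m (bottomEval j) → OpenTableau _ 0 m (true Vec.∷ j)
  to (T , rps , eval , bottom) = (Vec.[] , T) , isOpenTableau VecAll.[] rps eval bottom
  from : OpenTableau _ 0 m (true Vec.∷ j) → RPSTableau _ m (bottomEval j)
  from ((Vec.[] , T) , isOpenTableau VecAll.[] rps eval bottom) = T , rps , eval , bottom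

lemma4p3 : (k : ℕ) (m : Vec ℕ (suc k)) → (∀ a → 1 ≤ lookup m a) → (j : Vec Bool k) →
             RPSTableau (suc k) m (bottomEval j) ↔ Fin (formula m j)
lemma4p3 k m pos j =
  subst (λ c → RPSTableau (suc k) m (bottomEval j) ↔ Fin c) (openTableauCount≡formula m j pos)
    (↔-trans (RPSTableau↔OpenTableau m j)
             (OpenTableau↔Fin m (true Vec.∷ j) (λ a → ≤-trans (bit≤1 _) (pos a))))
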